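{- Let $f$ be a low-defect polynomial. Then $\|f\|$ equals the smallest value of $\|E\|$ among all low-defect expressions $E$ that evaluate to $f$.
   Context: $\|n\|$ is the least number of $1$'s needed to write $n\in\mathbb{N}$ using $1$, $+$, $\times$, parentheses. Low-defect expressions: (a) every positive integer constant is one; (b) the product of two low-defect expressions with disjoint variable sets is one; (c) if $E$ is one, $c$ a positive integer and $x$ a variable not in $E$, then $E\cdot x+c$ is one. Their complexity: $\|n\|$ for a constant $n$; $\|E_1\cdot E_2\|=\|E_1\|+\|E_2\|$; $\|E'\cdot x+c\|=\|E'\|+\|c\|$. Low-defect pairs form the smallest subset of $\mathbb{Z}[x_1,x_2,\ldots]\times\mathbb{N}$ such that: (i) $(k,C)$ is one for any constant $k\in\mathbb{N}$ and $C\ge\|k\|$; (ii) if $(f_1,C_1),(f_2,C_2)$ are ones, so is $(f_1\otimes f_2,C_1+C_2)$, where $f_1\otimes f_2$ is the product after relabeling variables so they share none; (iii) if $(f,C)$ is one, $c\in\mathbb{N}$, $D\ge\|c\|$, then $(f\cdot y+c,C+D)$ is one for a new variable $y$. Low-defect polynomials are the first coordinates of low-defect pairs (variables considered up to renaming), and $\|f\|$ is the smallest $C$ such that $(f,C)$ is a low-defect pair. -}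

module Defs where

open import Data.Nat using (ℕ; _+_; _*_; _≤_)
open import Data.Integer as ℤ using (ℤ)
open import Data.List using (List; []; _∷_; _++_)
open import Data.List.Membership.Propositional using (_∈_; _∉_)
open import Data.Product using (Σ; _×_; _,_)
open import Function.Definitions using (Injective)
open import Relation.Binary.PropositionalEquality using (_≡_)

-- Integer complexity ‖n‖ : least number of 1's in an expression built
-- from 1, +, × (parentheses = tree structure) whose value is n.

data OneExpr : Set where
  one  : OneExpr
  _⊞_  : OneExpr → OneExpr → OneExpr
  _⊠_  : OneExpr → OneExpr → OneExpr

value : OneExpr → ℕ
value one      = 1
value (a ⊞ b)  = value a + value b
value (a ⊠ b)  = value a * value b

ones : OneExpr → ℕ
ones one      = 1
ones (a ⊞ b)  = ones a + ones b
ones (a ⊠ b)  = ones a + ones b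

-- IsCpx n k  means  ‖n‖ = k  (only satisfiable for n ≥ 1).
IsCpx : ℕ → ℕ → Set
IsCpx n k = Σ OneExpr (λ e → value e ≡ n × ones e ≡ k)
          × (∀ e → value e ≡ n → k ≤ ones e)

IsLeast : (ℕ → Set) → ℕ → Set
IsLeast P m = P m × (∀ n → P n → m ≤ n)

-- Polynomials in ℤ[x₀, x₁, …], represented by terms; two terms denote the
-- same polynomial iff they agree at every integer assignment.

data Poly : Set where
  con  : ℕ → Poly
  var  : ℕ → Poly
  _⊕_  : Poly → Poly → Poly
  _⊗_  : Poly → Poly → Poly

infixl 6 _⊕_
infixl 7 _⊗_

eval : Poly → (ℕ → ℤ) → ℤ
eval (con n) ρ = ℤ.+ n
eval (var i) ρ = ρ i
eval (p ⊕ q) ρ = eval p ρ ℤ.+ eval q ρ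
eval (p ⊗ q) ρ = eval p ρ ℤ.* eval q ρ

_≈_ : Poly → Poly → Set
p ≈ q = ∀ (ρ : ℕ → ℤ) → eval p ρ ≡ eval q ρ

vars : Poly → List ℕ
vars (con n) = []
vars (var i) = i ∷ []
vars (p ⊕ q) = vars p ++ vars q
vars (p ⊗ q) = vars p ++ vars q

rename : (ℕ → ℕ) → Poly → Poly
rename σ (con n) = con n
rename σ (var i) = var (σ i)
rename σ (p ⊕ q) = rename σ p ⊕ rename σ q
rename σ (p ⊗ q) = rename σ p ⊗ rename σ q

Disjoint : List ℕ → List ℕ → Set
Disjoint xs ys = ∀ {x} → x ∈ xs → x ∉ ys

-- Low-defect pairs (rules (i)–(iii)).  In rule (ii) both factors are
-- relabelled by injective renamings so that they share no variable.

data LDPair : Poly → ℕ → Set where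
  const : (k C m : ℕ) → IsCpx k m → m ≤ C → LDPair (con k) C
  tensor : ∀ {f₁ f₂ C₁ C₂} → LDPair f₁ C₁ → LDPair f₂ C₂ →
           (σ₁ σ₂ : ℕ → ℕ) → Injective _≡_ _≡_ σ₁ → Injective _≡_ _≡_ σ₂ →
           Disjoint (vars (rename σ₁ f₁)) (vars (rename σ₂ f₂)) →
           LDPair (rename σ₁ f₁ ⊗ rename σ₂ f₂) (C₁ + C₂)
  affine : ∀ {f C} → LDPair f C → (c D m y : ℕ) → IsCpx c m → m ≤ D →
           y ∉ vars f → LDPair (f ⊗ var y ⊕ con c) (C + D)

-- (f , C) is a low-defect pair, f taken as an element of ℤ[x₀, x₁, …]
IsLDPair : Poly → ℕ → Set
IsLDPair f C = Σ Poly (λ g → LDPair g C × g ≈ f)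

LowDefectPoly : Poly → Set
LowDefectPoly f = Σ ℕ (λ C → IsLDPair f C)

data Expr : Set where
  cst : ℕ → Expr
  mul : Expr → Expr → Expr
  lin : Expr → ℕ → ℕ → Expr

exprVars : Expr → List ℕ
exprVars (cst n) = []
exprVars (mul E₁ E₂) = exprVars E₁ ++ exprVars E₂
exprVars (lin E x c) = x ∷ exprVars E

data LowDefectExpr : Expr → Set where
  cst : ∀ {n} → 1 ≤ n → LowDefectExpr (cst n)
  mul : ∀ {E₁ E₂} → LowDefectExpr E₁ → LowDefectExpr E₂ →
        Disjoint (exprVars E₁) (exprVars E₂) → LowDefectExpr (mul E₁ E₂)
  lin : ∀ {E x c} → LowDefectExpr E → x ∉ exprVars E → 1 ≤ c →
        LowDefectExpr (lin E x c)

toPoly : Expr → Poly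
toPoly (cst n) = con n
toPoly (mul E₁ E₂) = toPoly E₁ ⊗ toPoly E₂
toPoly (lin E x c) = toPoly E ⊗ var x ⊕ con c

data ExprCpx : Expr → ℕ → Set where
  cst : ∀ {n k} → IsCpx n k → ExprCpx (cst n) k
  mul : ∀ {E₁ E₂ a b} → ExprCpx E₁ a → ExprCpx E₂ b → ExprCpx (mul E₁ E₂) (a + b)
  lin : ∀ {E x c a b} → ExprCpx E a → IsCpx c b → ExprCpx (lin E x c) (a + b)

-- The rules generating low-defect pairs and the clauses of low-defect
-- expressions match one for one.  A derivation of (f , C) reads as an
-- expression for f whose complexity is the sum of the ‖k‖ and ‖c‖ it uses,
-- hence at most C; the relabellings of the product rule are applied to the
-- expression, which stays low-defect because they are injective.  Conversely
-- an expression E of complexity k reads back as a derivation of (E , k).  So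
-- every pair cost dominates an expression complexity and every expression
-- complexity is a pair cost, which forces the two minima to agree.
module Submission where

open import Defs
open import Data.Nat using (ℕ; suc; _+_; _≤_; s≤s; z≤n)
open import Data.Nat.Properties using (≤-refl; ≤-trans; ≤-antisym; +-mono-≤; m≤m+n)
open import Data.Product using (Σ; _×_; _,_)
open import Data.Sum using (inj₁; inj₂)
open import Data.List using ([]; _∷_; _++_; map)
open import Data.List.Properties using (map-++)
open import Data.List.Membership.Propositional using (_∈_; _∉_)
open import Data.List.Membership.Propositional.Properties using (∈-map⁻; ∈-++⁺ˡ; ∈-++⁺ʳ; ∈-++⁻)
open import Data.List.Relation.Unary.Any using (here; there)
open import Data.List.Relation.Binary.Subset.Propositional using (_⊆_)
open import Data.List.Relation.Binary.Subset.Propositional.Properties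
  using (map⁺; ++⁺; ∈-∷⁺ʳ; xs⊆xs++ys)
open import Function using (id; _∘_)
open import Function.Definitions using (Injective)
open import Relation.Binary.PropositionalEquality
  using (_≡_; refl; sym; trans; cong; cong₂; subst; subst₂; module ≡-Reasoning)
import Data.Integer as ℤ

Disjoint-mono : ∀ {xs xs′ ys ys′} → xs′ ⊆ xs → ys′ ⊆ ys → Disjoint xs ys → Disjoint xs′ ys′
Disjoint-mono xs′⊆xs ys′⊆ys d x∈xs′ x∈ys′ = d (xs′⊆xs x∈xs′) (ys′⊆ys x∈ys′)

∉-map⁺ : ∀ {σ : ℕ → ℕ} → Injective _≡_ _≡_ σ → ∀ {x xs} → x ∉ xs → σ x ∉ map σ xs
∉-map⁺ {σ} σ-inj x∉xs σx∈ with ∈-map⁻ σ σx∈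
... | z , z∈xs , σx≡σz = x∉xs (subst (_∈ _) (sym (σ-inj σx≡σz)) z∈xs)

Disjoint-map⁺ : ∀ {σ : ℕ → ℕ} → Injective _≡_ _≡_ σ →
                ∀ {xs ys} → Disjoint xs ys → Disjoint (map σ xs) (map σ ys)
Disjoint-map⁺ {σ} σ-inj d x∈ y∈ with ∈-map⁻ σ x∈
... | z , z∈xs , refl = ∉-map⁺ σ-inj (d z∈xs) y∈

eval-rename : ∀ σ p ρ → eval (rename σ p) ρ ≡ eval p (ρ ∘ σ)
eval-rename σ (con n) ρ = refl
eval-rename σ (var i) ρ = refl
eval-rename σ (p ⊕ q) ρ = cong₂ ℤ._+_ (eval-rename σ p ρ) (eval-rename σ q ρ)
eval-rename σ (p ⊗ q) ρ = cong₂ ℤ._*_ (eval-rename σ p ρ) (eval-rename σ q ρ)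

vars-rename : ∀ σ p → vars (rename σ p) ≡ map σ (vars p)
vars-rename σ (con n) = refl
vars-rename σ (var i) = refl
vars-rename σ (p ⊕ q) = trans (cong₂ _++_ (vars-rename σ p) (vars-rename σ q)) (sym (map-++ σ (vars p) (vars q)))
vars-rename σ (p ⊗ q) = trans (cong₂ _++_ (vars-rename σ p) (vars-rename σ q)) (sym (map-++ σ (vars p) (vars q)))

rename-id : ∀ p → rename id p ≡ p
rename-id (con n) = refl
rename-id (var i) = refl
rename-id (p ⊕ q) = cong₂ _⊕_ (rename-id p) (rename-id q)
rename-id (p ⊗ q) = cong₂ _⊗_ (rename-id p) (rename-id q)

tensor-disjoint : ∀ {f₁ f₂ C₁ C₂} → LDPair f₁ C₁ → LDPair f₂ C₂ →
                  Disjoint (vars f₁) (vars f₂) → LDPair (f₁ ⊗ f₂) (C₁ + C₂)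
tensor-disjoint {f₁} {f₂} p₁ p₂ d =
  subst₂ (λ g₁ g₂ → LDPair (g₁ ⊗ g₂) _) (rename-id f₁) (rename-id f₂)
    (tensor p₁ p₂ id id id id
      (subst₂ Disjoint (cong vars (sym (rename-id f₁))) (cong vars (sym (rename-id f₂))) d))

renameE : (ℕ → ℕ) → Expr → Expr
renameE σ (cst n)     = cst n
renameE σ (mul E₁ E₂) = mul (renameE σ E₁) (renameE σ E₂)
renameE σ (lin E x c) = lin (renameE σ E) (σ x) c

toPoly-renameE : ∀ σ E → toPoly (renameE σ E) ≡ rename σ (toPoly E)
toPoly-renameE σ (cst n)     = refl
toPoly-renameE σ (mul E₁ E₂) = cong₂ _⊗_ (toPoly-renameE σ E₁) (toPoly-renameE σ E₂)
toPoly-renameE σ (lin E x c) = cong (λ p → p ⊗ var (σ x) ⊕ con c) (toPoly-renameE σ E)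

exprVars-renameE : ∀ σ E → exprVars (renameE σ E) ≡ map σ (exprVars E)
exprVars-renameE σ (cst n)     = refl
exprVars-renameE σ (mul E₁ E₂) =
  trans (cong₂ _++_ (exprVars-renameE σ E₁) (exprVars-renameE σ E₂))
        (sym (map-++ σ (exprVars E₁) (exprVars E₂)))
exprVars-renameE σ (lin E x c) = cong (σ x ∷_) (exprVars-renameE σ E)

renameE-≈ : ∀ σ E g → toPoly E ≈ g → toPoly (renameE σ E) ≈ rename σ g
renameE-≈ σ E g E≈g ρ = begin
  eval (toPoly (renameE σ E)) ρ  ≡⟨ cong (λ h → eval h ρ) (toPoly-renameE σ E) ⟩
  eval (rename σ (toPoly E)) ρ   ≡⟨ eval-rename σ (toPoly E) ρ ⟩
  eval (toPoly E) (ρ ∘ σ)        ≡⟨ E≈g (ρ ∘ σ) ⟩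
  eval g (ρ ∘ σ)                 ≡⟨ sym (eval-rename σ g ρ) ⟩
  eval (rename σ g) ρ            ∎
  where open ≡-Reasoning

renameE-vars⊆ : ∀ σ E g → exprVars E ⊆ vars g → exprVars (renameE σ E) ⊆ vars (rename σ g)
renameE-vars⊆ σ E g E⊆g =
  subst₂ _⊆_ (sym (exprVars-renameE σ E)) (sym (vars-rename σ g)) (map⁺ σ E⊆g)

renameE-lowDefect : ∀ {σ} → Injective _≡_ _≡_ σ → ∀ {E} → LowDefectExpr E → LowDefectExpr (renameE σ E)
renameE-lowDefect σ-inj (cst 1≤n) = cst 1≤n
renameE-lowDefect {σ} σ-inj (mul {E₁} {E₂} l₁ l₂ d) =
  mul (renameE-lowDefect σ-inj l₁) (renameE-lowDefect σ-inj l₂)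
      (subst₂ Disjoint (sym (exprVars-renameE σ E₁)) (sym (exprVars-renameE σ E₂))
              (Disjoint-map⁺ σ-inj d))
renameE-lowDefect {σ} σ-inj (lin {E} {x} l x∉E 1≤c) =
  lin (renameE-lowDefect σ-inj l)
      (subst (σ x ∉_) (sym (exprVars-renameE σ E)) (∉-map⁺ σ-inj x∉E)) 1≤c

renameE-cpx : ∀ σ {E k} → ExprCpx E k → ExprCpx (renameE σ E) k
renameE-cpx σ (cst n-cpx)   = cst n-cpx
renameE-cpx σ (mul c₁ c₂)   = mul (renameE-cpx σ c₁) (renameE-cpx σ c₂)
renameE-cpx σ (lin c c-cpx) = lin (renameE-cpx σ c) c-cpx

1≤value : ∀ e → 1 ≤ value e
1≤value one     = s≤s z≤n
1≤value (a ⊞ b) = ≤-trans (1≤value a) (m≤m+n _ _)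
1≤value (a ⊠ b) with value a | 1≤value a | value b | 1≤value b
... | suc _ | s≤s _ | suc _ | s≤s _ = s≤s z≤n

IsCpx⇒1≤ : ∀ {n k} → IsCpx n k → 1 ≤ n
IsCpx⇒1≤ ((e , refl , _) , _) = 1≤value e

toExpr : ∀ {g C} → LDPair g C → Expr
toExpr (const k _ _ _ _)           = cst k
toExpr (tensor p₁ p₂ σ₁ σ₂ _ _ _)  = mul (renameE σ₁ (toExpr p₁)) (renameE σ₂ (toExpr p₂))
toExpr (affine p c _ _ y _ _ _)    = lin (toExpr p) y c

-- C without the slack allowed by C ≥ ‖k‖ and D ≥ ‖c‖.
toExprCost : ∀ {g C} → LDPair g C → ℕ
toExprCost (const _ _ m _ _)          = m
toExprCost (tensor p₁ p₂ _ _ _ _ _)   = toExprCost p₁ + toExprCost p₂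
toExprCost (affine p _ _ m _ _ _ _)   = toExprCost p + m

toExprCost≤ : ∀ {g C} (p : LDPair g C) → toExprCost p ≤ C
toExprCost≤ (const _ _ _ _ m≤C)         = m≤C
toExprCost≤ (tensor p₁ p₂ _ _ _ _ _)    = +-mono-≤ (toExprCost≤ p₁) (toExprCost≤ p₂)
toExprCost≤ (affine p _ _ _ _ _ m≤D _)  = +-mono-≤ (toExprCost≤ p) m≤D

toExpr-cpx : ∀ {g C} (p : LDPair g C) → ExprCpx (toExpr p) (toExprCost p)
toExpr-cpx (const _ _ _ k-cpx _)           = cst k-cpx
toExpr-cpx (tensor p₁ p₂ σ₁ σ₂ _ _ _)      = mul (renameE-cpx σ₁ (toExpr-cpx p₁)) (renameE-cpx σ₂ (toExpr-cpx p₂))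
toExpr-cpx (affine p _ _ _ _ c-cpx _ _)    = lin (toExpr-cpx p) c-cpx

toExpr-≈ : ∀ {g C} (p : LDPair g C) → toPoly (toExpr p) ≈ g
toExpr-≈ (const _ _ _ _ _)          ρ = refl
toExpr-≈ (tensor {f₁} {f₂} p₁ p₂ σ₁ σ₂ _ _ _) ρ =
  cong₂ ℤ._*_ (renameE-≈ σ₁ (toExpr p₁) f₁ (toExpr-≈ p₁) ρ) (renameE-≈ σ₂ (toExpr p₂) f₂ (toExpr-≈ p₂) ρ)
toExpr-≈ (affine p c _ _ y _ _ _)   ρ = cong (λ z → z ℤ.* ρ y ℤ.+ ℤ.+ c) (toExpr-≈ p ρ)

exprVars-toExpr : ∀ {g C} (p : LDPair g C) → exprVars (toExpr p) ⊆ vars g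
exprVars-toExpr (const _ _ _ _ _) ()
exprVars-toExpr (tensor {f₁} {f₂} p₁ p₂ σ₁ σ₂ _ _ _) =
  ++⁺ (renameE-vars⊆ σ₁ (toExpr p₁) f₁ (exprVars-toExpr p₁))
      (renameE-vars⊆ σ₂ (toExpr p₂) f₂ (exprVars-toExpr p₂))
exprVars-toExpr (affine {f} p _ _ _ y _ _ _) =
  ∈-∷⁺ʳ (∈-++⁺ˡ (∈-++⁺ʳ (vars f) (here refl)))
        (xs⊆xs++ys _ _ ∘ xs⊆xs++ys _ _ ∘ exprVars-toExpr p)

toExpr-lowDefect : ∀ {g C} (p : LDPair g C) → LowDefectExpr (toExpr p)
toExpr-lowDefect (const _ _ _ k-cpx _) = cst (IsCpx⇒1≤ k-cpx)
toExpr-lowDefect (tensor {f₁} {f₂} p₁ p₂ σ₁ σ₂ σ₁-inj σ₂-inj d) =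
  mul (renameE-lowDefect σ₁-inj (toExpr-lowDefect p₁))
      (renameE-lowDefect σ₂-inj (toExpr-lowDefect p₂))
      (Disjoint-mono (renameE-vars⊆ σ₁ (toExpr p₁) f₁ (exprVars-toExpr p₁))
                     (renameE-vars⊆ σ₂ (toExpr p₂) f₂ (exprVars-toExpr p₂)) d)
toExpr-lowDefect (affine p _ _ _ _ c-cpx _ y∉f) =
  lin (toExpr-lowDefect p) (y∉f ∘ exprVars-toExpr p) (IsCpx⇒1≤ c-cpx)

vars-toPoly : ∀ E → vars (toPoly E) ⊆ exprVars E
vars-toPoly (cst n) ()
vars-toPoly (mul E₁ E₂) = ++⁺ (vars-toPoly E₁) (vars-toPoly E₂)
vars-toPoly (lin E x c) q with ∈-++⁻ (vars (toPoly E) ++ x ∷ []) q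
... | inj₂ ()
... | inj₁ q′ with ∈-++⁻ (vars (toPoly E)) q′
...   | inj₁ u          = there (vars-toPoly E u)
...   | inj₂ (here refl) = here refl

toLDPair : ∀ {E k} → LowDefectExpr E → ExprCpx E k → LDPair (toPoly E) k
toLDPair (cst _) (cst {n} {k} n-cpx) = const n k k n-cpx ≤-refl
toLDPair (mul {E₁} {E₂} l₁ l₂ d) (mul c₁ c₂) =
  tensor-disjoint (toLDPair l₁ c₁) (toLDPair l₂ c₂) (Disjoint-mono (vars-toPoly E₁) (vars-toPoly E₂) d)
toLDPair (lin {E} {x} {c} l x∉E _) (lin {b = b} cE c-cpx) =
  affine (toLDPair l cE) c b b x c-cpx ≤-refl (x∉E ∘ vars-toPoly E)

HasLowDefectExpr : Poly → ℕ → Set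
HasLowDefectExpr f k = Σ Expr (λ E → LowDefectExpr E × toPoly E ≈ f × ExprCpx E k)

IsLDPair⇒HasLowDefectExpr : ∀ {f C} → IsLDPair f C → Σ ℕ λ k → HasLowDefectExpr f k × k ≤ C
IsLDPair⇒HasLowDefectExpr (g , p , g≈f) =
  toExprCost p , (toExpr p , toExpr-lowDefect p , (λ ρ → trans (toExpr-≈ p ρ) (g≈f ρ)) , toExpr-cpx p) , toExprCost≤ p

HasLowDefectExpr⇒IsLDPair : ∀ {f k} → HasLowDefectExpr f k → IsLDPair f k
HasLowDefectExpr⇒IsLDPair (E , l , E≈f , c) = toPoly E , toLDPair l c , E≈f

IsLeast-⇔ : {P Q : ℕ → Set} → (∀ {n} → P n → Σ ℕ λ k → Q k × k ≤ n) → (∀ {n} → Q n → P n) →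
            ∀ m → (IsLeast P m → IsLeast Q m) × (IsLeast Q m → IsLeast P m)
IsLeast-⇔ {P} {Q} P⇒Q≤ Q⇒P m = P-least⇒Q-least , Q-least⇒P-least
  where
  P-least⇒Q-least : IsLeast P m → IsLeast Q m
  P-least⇒Q-least (Pm , m≤P) with P⇒Q≤ Pm
  ... | k , Qk , k≤m = subst Q (≤-antisym k≤m (m≤P k (Q⇒P Qk))) Qk , λ n → m≤P n ∘ Q⇒P

  Q-least⇒P-least : IsLeast Q m → IsLeast P m
  Q-least⇒P-least (Qm , m≤Q) = Q⇒P Qm , λ n Pn → let (k , Qk , k≤n) = P⇒Q≤ Pn in ≤-trans (m≤Q k Qk) k≤n

proposition3p21 : (f : Poly) → LowDefectPoly f → (m : ℕ) →
    (IsLeast (λ C → IsLDPair f C) m →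
       IsLeast (λ k → Σ Expr (λ E → LowDefectExpr E × toPoly E ≈ f × ExprCpx E k)) m)
    × (IsLeast (λ k → Σ Expr (λ E → LowDefectExpr E × toPoly E ≈ f × ExprCpx E k)) m →
       IsLeast (λ C → IsLDPair f C) m)
proposition3p21 f _ = IsLeast-⇔ (IsLDPair⇒HasLowDefectExpr {f}) (HasLowDefectExpr⇒IsLDPair {f})
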